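{- Let $L$ be a primitive Gaussian line. Then $g_L\ge 7$. Moreover, $g_L=7$ if and only if $1+i,\,3,\,1+2i,\,1-2i\in\mathcal{D}(L)$ and the conjugate primes $1+2i$ and $1-2i$ divide consecutive Gaussian integers on $L$, i.e., there is an integer $t$ such that either $1+2i\mid\alpha_t$ and $1-2i\mid\alpha_{t+1}$, or $1-2i\mid\alpha_t$ and $1+2i\mid\alpha_{t+1}$.
   Context: A Gaussian line is a line in the complex plane containing at least two (hence infinitely many) Gaussian integers; it is primitive if it contains two Gaussian integers that are coprime in $\mathbb{Z}[i]$. For a Gaussian line $L$, let $\alpha_0$ be the Gaussian integer on $L$ of minimum norm $N(x+iy)=x^2+y^2$ (if there are two such, take the one with larger real part). If $L$ is vertical, set $\delta=i$; otherwise let $\alpha_1$ be the Gaussian integer on $L$ with $\mathrm{Re}(\alpha_1)>\mathrm{Re}(\alpha_0)$ that is closest to $\alpha_0$, and set $\delta=\alpha_1-\alpha_0$. Then the Gaussian integers on $L$ are exactly $\alpha_m=\alpha_0+m\delta$ for $m\in\mathbb{Z}$. The divisor set $\mathcal{D}(L)$ is the set of Gaussian integers dividing at least one Gaussian integer on $L$. A finite list of Gaussian integers has the property that "none is coprime to all the others" if each term shares a common non-unit divisor in $\mathbb{Z}[i]$ with some other term of the list. For a primitive Gaussian line $L$, $g_L$ denotes the smallest integer $n\ge 2$ such that there exist $n$ consecutive terms $\alpha_{k+1},\alpha_{k+2},\dots,\alpha_{k+n}$ of the sequence $(\alpha_0,\alpha_1,\alpha_2,\dots)$ none of which is coprime to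 all the others (such $n$ exists for every primitive Gaussian line). -}

module Defs where

open import Data.Nat as ℕ using (ℕ)
open import Data.Integer as ℤ using (ℤ; +_; -[1+_])
open import Data.Product using (Σ; ∃; _×_; _,_)
open import Data.Sum using (_⊎_)
open import Relation.Nullary using (¬_)
open import Relation.Binary.PropositionalEquality using (_≡_; _≢_)
open import Function.Bundles using (_⇔_)

record 𝔾 : Set where
  constructor _+i_
  field
    re : ℤ
    im : ℤ
open 𝔾 public

infixl 6 _⊕_ _⊖_
infixl 7 _⊛_

_⊕_ : 𝔾 → 𝔾 → 𝔾
(a +i b) ⊕ (c +i d) = (a ℤ.+ c) +i (b ℤ.+ d)

_⊖_ : 𝔾 → 𝔾 → 𝔾
(a +i b) ⊖ (c +i d) = (a ℤ.- c) +i (b ℤ.- d)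

_⊛_ : 𝔾 → 𝔾 → 𝔾
(a +i b) ⊛ (c +i d) = (a ℤ.* c ℤ.- b ℤ.* d) +i (a ℤ.* d ℤ.+ b ℤ.* c)

_·_ : ℤ → 𝔾 → 𝔾
m · (a +i b) = (m ℤ.* a) +i (m ℤ.* b)

N : 𝔾 → ℤ
N (a +i b) = a ℤ.* a ℤ.+ b ℤ.* b

_∣_ : 𝔾 → 𝔾 → Set
a ∣ b = ∃ λ c → b ≡ a ⊛ c

IsUnit : 𝔾 → Set
IsUnit u = u ∣ ((+ 1) +i (+ 0))

Coprime : 𝔾 → 𝔾 → Set
Coprime a b = ∀ d → d ∣ a → d ∣ b → IsUnit d

-- Gaussian lines: a line in ℂ containing at least two Gaussian integers
-- is the line through two distinct Gaussian integers p ≠ q.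

record GaussianLine : Set where
  field
    p q  : 𝔾
    p≢q  : p ≢ q
open GaussianLine public

-- "cross product" Im(conj(u) v)
cross : 𝔾 → 𝔾 → ℤ
cross (a +i b) (c +i d) = a ℤ.* d ℤ.- b ℤ.* c

-- the Gaussian integer z lies on L (z - p is a real multiple of q - p)
OnLine : GaussianLine → 𝔾 → Set
OnLine L z = cross (z ⊖ p L) (q L ⊖ p L) ≡ + 0

Primitive : GaussianLine → Set
Primitive L = Σ 𝔾 λ z → Σ 𝔾 λ w → OnLine L z × OnLine L w × Coprime z w

Vertical : GaussianLine → Set
Vertical L = re (p L) ≡ re (q L)

IsAlpha0 : GaussianLine → 𝔾 → Set
IsAlpha0 L a =
  OnLine L a ×
  (∀ z → OnLine L z → N a ℤ.≤ N z) ×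
  (∀ z → OnLine L z → N z ≡ N a → re z ℤ.≤ re a)

IsDelta : GaussianLine → 𝔾 → 𝔾 → Set
IsDelta L a δ =
  (Vertical L × δ ≡ ((+ 0) +i (+ 1))) ⊎
  (¬ Vertical L × Σ 𝔾 λ a₁ →
     OnLine L a₁ × re a ℤ.< re a₁ ×
     (∀ z → OnLine L z → re a ℤ.< re z → N (a₁ ⊖ a) ℤ.≤ N (z ⊖ a)) ×
     δ ≡ a₁ ⊖ a)

seqα : 𝔾 → 𝔾 → ℤ → 𝔾
seqα a δ m = a ⊕ (m · δ)

_∈𝒟_ : 𝔾 → GaussianLine → Set
d ∈𝒟 L = Σ 𝔾 λ z → OnLine L z × d ∣ z

NoneCoprimeToOthers : 𝔾 → 𝔾 → ℕ → ℕ → Set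
NoneCoprimeToOthers a δ s n =
  ∀ i → i ℕ.< n → Σ ℕ λ j → j ℕ.< n × i ≢ j ×
    Σ 𝔾 λ d → ¬ IsUnit d ×
      d ∣ seqα a δ (+ (s ℕ.+ i)) × d ∣ seqα a δ (+ (s ℕ.+ j))

Good : 𝔾 → 𝔾 → ℕ → Set
Good a δ n = Σ ℕ λ s → NoneCoprimeToOthers a δ s n

IsG : 𝔾 → 𝔾 → ℕ → Set
IsG a δ g = 2 ℕ.≤ g × Good a δ g × (∀ n → 2 ℕ.≤ n → n ℕ.< g → ¬ Good a δ n)

1+i 3ᵍ 1+2i 1-2i : 𝔾
1+i  = (+ 1) +i (+ 1)
3ᵍ   = (+ 3) +i (+ 0)
1+2i = (+ 1) +i (+ 2)
1-2i = (+ 1) +i (-[1+ 1 ])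

Cond7 : GaussianLine → 𝔾 → 𝔾 → Set
Cond7 L a δ =
  1+i ∈𝒟 L × 3ᵍ ∈𝒟 L × 1+2i ∈𝒟 L × 1-2i ∈𝒟 L ×
  Σ ℤ λ t →
    (1+2i ∣ seqα a δ t × 1-2i ∣ seqα a δ (t ℤ.+ + 1)) ⊎
    (1-2i ∣ seqα a δ t × 1+2i ∣ seqα a δ (t ℤ.+ + 1))

-- Write α_m = α₀ + m δ. Primitivity makes α₀ and δ coprime, so a common divisor d of α_m and
-- α_(m+g) divides g δ and g α₀, and is a unit as soon as N d is coprime to g. In a block of at most
-- seven terms every gap is at most 6, so each shared non-unit factor is divisible by one of the
-- primes 1+i, 3, 1+2i, 1-2i above 2, 3 and 5, and each of these divides the terms of exactly one
-- residue class of indices modulo 2, 3, 5, 5, or none. A finite check over these class patterns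
-- shows that no block of at most six terms has every term sharing a factor with another, and that a
-- block of seven does only when 1+i and 3 divide some terms and 1+2i, 1-2i divide adjacent ones.
-- Conversely, aligning such classes by the Chinese remainder theorem gives a block of seven.

module Submission where

open import Defs
open import Data.Nat using (ℕ; _≤_)
open import Data.Product using (_×_)
open import Relation.Binary.PropositionalEquality using (_≡_)
open import Function.Bundles using (_⇔_)

open import Data.Bool using (Bool; T; not; _∧_; _∨_)
import Data.Bool.Properties as Boolᵖ
open import Data.Bool.ListAction using (all; any)
open import Data.Empty using (⊥-elim)
open import Data.Fin using (toℕ)
open import Data.Fin.Subset.Properties using (anySubset?)
open import Data.Integer as ℤ using (ℤ; +_; +[1+_]; -[1+_]; _+_; _*_; _-_; -_)
open import Data.Integer.DivMod using (_%ℕ_; _/ℕ_; a≡a%ℕn+[a/ℕn]*n; n%ℕd<d)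
open import Data.Integer.Divisibility.Signed
  using (divides; _∣?_; ∣ᵤ⇒∣; ∣m+n∣n⇒∣m; ∣m⇒∣-m; ∣m∣n⇒∣m+n) renaming (_∣_ to _∣ℤ_)
import Data.Integer.Properties as ℤᵖ
open import Data.Integer.Tactic.RingSolver using (solve-∀)
open import Data.List using (List; []; _∷_; upTo; map; cartesianProduct)
import Data.List.Membership.DecPropositional as DecMembership
open import Data.List.Membership.Propositional using (_∈_; find; lose)
open import Data.List.Membership.Propositional.Properties using (∈-upTo⁺; ∈-upTo⁻; ∈-cartesianProduct⁺)
import Data.List.Relation.Unary.All as All
open import Data.List.Relation.Unary.All.Properties using (all⁺; all⁻)
open import Data.List.Relation.Unary.Any using (here; there)
open import Data.List.Relation.Unary.Any.Properties using (any⁺; any⁻)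
open import Data.Nat as ℕ using (zero; suc; _<_; _∸_; NonZero; z≤n; s≤s)
import Data.Nat.Coprimality as ℕᶜ
import Data.Nat.Divisibility as ℕᵈ
open ℕᵈ using () renaming (_∣_ to _∣ℕ_; _∣?_ to _∣ℕ?_)
open import Data.Nat.DivMod using (_%_; [m+kn]%n≡m%n; m≡m%n+[m/n]*n)
open import Data.Nat.GCD using (module Bézout)
open Bézout.Identity using (Identity; +-; -+)
open import Data.Nat.Primality using (Prime; prime[2]; prime?; prime⇒irreducible)
import Data.Nat.Properties as ℕᵖ
open import Data.Product using (Σ; ∃; _,_; proj₁; proj₂)
open import Data.Sum as Sum using (_⊎_; inj₁; inj₂; [_,_]′)
open import Data.Vec using (Vec; []; _∷_; tabulate; replicate)
open import Data.Vec.Properties using (≡-dec)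
open import Function using (_∘_)
open import Function.Bundles using (mk⇔; Equivalence)
open import Relation.Binary.PropositionalEquality
  using (_≢_; refl; sym; trans; cong; cong₂; subst; subst₂; module ≡-Reasoning)
open import Relation.Nullary using (¬_; Dec; yes; no)
open import Relation.Nullary.Decidable
  using (map′; _×-dec_; _⊎-dec_; _→-dec_; ¬?; T?; isYes; toWitness; fromWitness; from-yes; from-no;
         decidable-stable)

module _ {f : ℕ → Bool} {n : ℕ} where

  T-all-upTo : T (all f (upTo n)) → ∀ {i} → i < n → T (f i)
  T-all-upTo h i<n = All.lookup (all⁺ f _ h) (∈-upTo⁺ i<n)

  all-upTo⁺ : (∀ {i} → i < n → T (f i)) → T (all f (upTo n))
  all-upTo⁺ h = all⁻ f (All.tabulate (h ∘ ∈-upTo⁻))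

  T-any-upTo : T (any f (upTo n)) → ∃ λ i → i < n × T (f i)
  T-any-upTo h = let i , i∈ , fi = find (any⁻ f _ h) in i , ∈-upTo⁻ i∈ , fi

  any-upTo⁺ : ∀ {i} → i < n → T (f i) → T (any f (upTo n))
  any-upTo⁺ i<n fi = any⁺ f (lose (∈-upTo⁺ i<n) fi)

-- Arithmetic in ℤ[i]

ι : ℤ → 𝔾
ι m = m +i (+ 0)

conj : 𝔾 → 𝔾
conj (a +i b) = a +i (- b)

⊛-assoc : ∀ x y z → (x ⊛ y) ⊛ z ≡ x ⊛ (y ⊛ z)
⊛-assoc (a +i b) (c +i d) (e +i f) = cong₂ _+i_ (re≡ a b c d e f) (im≡ a b c d e f)
  where
  re≡ : ∀ a b c d e f → (a * c - b * d) * e - (a * d + b * c) * f ≡ a * (c * e - d * f) - b * (c * f + d * e)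
  re≡ = solve-∀
  im≡ : ∀ a b c d e f → (a * c - b * d) * f + (a * d + b * c) * e ≡ a * (c * f + d * e) + b * (c * e - d * f)
  im≡ = solve-∀

⊛-distribˡ-⊕ : ∀ x y z → x ⊛ (y ⊕ z) ≡ x ⊛ y ⊕ x ⊛ z
⊛-distribˡ-⊕ (a +i b) (c +i d) (e +i f) = cong₂ _+i_ (re≡ a b c d e f) (im≡ a b c d e f)
  where
  re≡ : ∀ a b c d e f → a * (c + e) - b * (d + f) ≡ (a * c - b * d) + (a * e - b * f)
  re≡ = solve-∀
  im≡ : ∀ a b c d e f → a * (d + f) + b * (c + e) ≡ (a * d + b * c) + (a * f + b * e)
  im≡ = solve-∀

⊛-distribˡ-⊖ : ∀ x y z → x ⊛ (y ⊖ z) ≡ x ⊛ y ⊖ x ⊛ z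
⊛-distribˡ-⊖ (a +i b) (c +i d) (e +i f) = cong₂ _+i_ (re≡ a b c d e f) (im≡ a b c d e f)
  where
  re≡ : ∀ a b c d e f → a * (c - e) - b * (d - f) ≡ (a * c - b * d) - (a * e - b * f)
  re≡ = solve-∀
  im≡ : ∀ a b c d e f → a * (d - f) + b * (c - e) ≡ (a * d + b * c) - (a * f + b * e)
  im≡ = solve-∀

·-⊛-comm : ∀ m x y → m · (x ⊛ y) ≡ x ⊛ (m · y)
·-⊛-comm m (a +i b) (c +i d) = cong₂ _+i_ (re≡ m a b c d) (im≡ m a b c d)
  where
  re≡ : ∀ m a b c d → m * (a * c - b * d) ≡ a * (m * c) - b * (m * d)
  re≡ = solve-∀
  im≡ : ∀ m a b c d → m * (a * d + b * c) ≡ a * (m * d) + b * (m * c)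
  im≡ = solve-∀

·-as-⊛ : ∀ m x → m · x ≡ ι m ⊛ x
·-as-⊛ m (a +i b) = cong₂ _+i_ (re≡ m a b) (im≡ m a b)
  where
  re≡ : ∀ m a b → m * a ≡ m * a - + 0 * b
  re≡ = solve-∀
  im≡ : ∀ m a b → m * b ≡ m * b + + 0 * a
  im≡ = solve-∀

⊛-conj : ∀ x → x ⊛ conj x ≡ ι (N x)
⊛-conj (a +i b) = cong₂ _+i_ (re≡ a b) (im≡ a b)
  where
  re≡ : ∀ a b → a * a - b * (- b) ≡ a * a + b * b
  re≡ = solve-∀
  im≡ : ∀ a b → a * (- b) + b * a ≡ + 0
  im≡ = solve-∀

⊛-⊛conj : ∀ x y → (x ⊛ y) ⊛ conj x ≡ N x · y
⊛-⊛conj (a +i b) (c +i d) = cong₂ _+i_ (re≡ a b c d) (im≡ a b c d)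
  where
  re≡ : ∀ a b c d → (a * c - b * d) * a - (a * d + b * c) * (- b) ≡ (a * a + b * b) * c
  re≡ = solve-∀
  im≡ : ∀ a b c d → (a * c - b * d) * (- b) + (a * d + b * c) * a ≡ (a * a + b * b) * d
  im≡ = solve-∀

N-⊛ : ∀ x y → N (x ⊛ y) ≡ N x * N y
N-⊛ (a +i b) (c +i d) = lemma a b c d
  where
  lemma : ∀ a b c d → (a * c - b * d) * (a * c - b * d) + (a * d + b * c) * (a * d + b * c)
                      ≡ (a * a + b * b) * (c * c + d * d)
  lemma = solve-∀

0≤i*i : ∀ i → + 0 ℤ.≤ i * i
0≤i*i (+ n) = subst (+ 0 ℤ.≤_) (ℤᵖ.pos-* n n) (ℤ.+≤+ z≤n)
0≤i*i -[1+ n ] = ℤ.+≤+ z≤n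

0≤N : ∀ x → + 0 ℤ.≤ N x
0≤N (a +i b) = ℤᵖ.+-mono-≤ (0≤i*i a) (0≤i*i b)

·-cancelˡ : ∀ m {x y} → m ≢ + 0 → m · x ≡ m · y → x ≡ y
·-cancelˡ m {a +i b} {c +i d} m≢0 eq = cong₂ _+i_ (cancel (cong re eq)) (cancel (cong im eq))
  where
  instance
    _ : ℤ.NonZero m
    _ = ℤ.≢-nonZero m≢0
  cancel : ∀ {u v} → m * u ≡ m * v → u ≡ v
  cancel = ℤᵖ.*-cancelˡ-≡ m _ _

∣-trans : ∀ {x y z} → x ∣ y → y ∣ z → x ∣ z
∣-trans {x} (c , refl) (c′ , refl) = c ⊛ c′ , ⊛-assoc x c c′

∣x⇒∣x⊛y : ∀ {d x} y → d ∣ x → d ∣ (x ⊛ y)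
∣x⇒∣x⊛y {d} y (c , refl) = c ⊛ y , ⊛-assoc d c y

∣x∣y⇒∣x⊕y : ∀ {d x y} → d ∣ x → d ∣ y → d ∣ (x ⊕ y)
∣x∣y⇒∣x⊕y {d} (c , refl) (c′ , refl) = c ⊕ c′ , sym (⊛-distribˡ-⊕ d c c′)

∣x∣y⇒∣x⊖y : ∀ {d x y} → d ∣ x → d ∣ y → d ∣ (x ⊖ y)
∣x∣y⇒∣x⊖y {d} (c , refl) (c′ , refl) = c ⊖ c′ , sym (⊛-distribˡ-⊖ d c c′)

∣x⇒∣m·x : ∀ {d x} m → d ∣ x → d ∣ (m · x)
∣x⇒∣m·x {d} m (c , refl) = m · c , ·-⊛-comm m d c

∣-resp-≡ : ∀ {d x y} → x ≡ y → d ∣ x → d ∣ y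
∣-resp-≡ refl d∣x = d∣x

∣ι⇒∣· : ∀ {d m} x → d ∣ ι m → d ∣ (m · x)
∣ι⇒∣· {d} {m} x d∣m = ∣-resp-≡ {d} (sym (·-as-⊛ m x)) (∣x⇒∣x⊛y {d} x d∣m)

∣ι-N : ∀ x → x ∣ ι (N x)
∣ι-N x = conj x , sym (⊛-conj x)

N-mono-∣ : ∀ {d x} → d ∣ x → N d ∣ℤ N x
N-mono-∣ {d} (c , refl) = divides (N c) (trans (N-⊛ d c) (ℤᵖ.*-comm (N d) (N c)))

-- Multiplying by conj d reduces division by d to division of integers by N d.
∣⇔∣conj : ∀ {d z} → N d ≢ + 0 →
          d ∣ z ⇔ (N d ∣ℤ re (z ⊛ conj d) × N d ∣ℤ im (z ⊛ conj d))
∣⇔∣conj {d} {z} Nd≢0 = mk⇔ to from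
  where
  scale : ∀ y → (d ⊛ y) ⊛ conj d ≡ N d · y
  scale = ⊛-⊛conj d
  Divides = N d ∣ℤ re (z ⊛ conj d) × N d ∣ℤ im (z ⊛ conj d)
  to : d ∣ z → Divides
  to (c , refl) = divides (re c) (trans (cong re (scale c)) (ℤᵖ.*-comm (N d) (re c)))
                , divides (im c) (trans (cong im (scale c)) (ℤᵖ.*-comm (N d) (im c)))
  from : Divides → d ∣ z
  from (divides q₁ e₁ , divides q₂ e₂) = c , ·-cancelˡ (N d) Nd≢0 (begin
      N d · z              ≡⟨ sym (scale z) ⟩
      (d ⊛ z) ⊛ conj d     ≡⟨ ⊛-assoc d z (conj d) ⟩
      d ⊛ (z ⊛ conj d)     ≡⟨ cong (d ⊛_) z⊛conj ⟩
      d ⊛ (N d · c)        ≡⟨ sym (·-⊛-comm (N d) d c) ⟩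
      N d · (d ⊛ c)        ∎)
    where
    open ≡-Reasoning
    c = q₁ +i q₂
    z⊛conj : z ⊛ conj d ≡ N d · c
    z⊛conj = cong₂ _+i_ (trans e₁ (ℤᵖ.*-comm q₁ (N d))) (trans e₂ (ℤᵖ.*-comm q₂ (N d)))

∣-dec : ∀ {d} → N d ≢ + 0 → ∀ z → Dec (d ∣ z)
∣-dec {d} Nd≢0 z = map′ (Equivalence.from eqv) (Equivalence.to eqv)
  ((N d ∣? re (z ⊛ conj d)) ×-dec (N d ∣? im (z ⊛ conj d)))
  where eqv = ∣⇔∣conj {d} {z} Nd≢0

-- The Gaussian integers on a line

infix 4 _∥_

_∥_ : 𝔾 → 𝔾 → Set
u ∥ v = cross u v ≡ + 0

0ᵍ : 𝔾
0ᵍ = ι (+ 0)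

direction : GaussianLine → 𝔾
direction L = q L ⊖ p L

direction≢0 : ∀ L → direction L ≢ 0ᵍ
direction≢0 L dir≡0 = p≢q L (cong₂ _+i_ (coordinate (cong re dir≡0)) (coordinate (cong im dir≡0)))
  where
  coordinate : ∀ {u v} → v - u ≡ + 0 → u ≡ v
  coordinate v-u≡0 = sym (ℤᵖ.i-j≡0⇒i≡j _ _ v-u≡0)

cross-⊖ : ∀ z w u v → cross (z ⊖ w) v ≡ cross (z ⊖ u) v - cross (w ⊖ u) v
cross-⊖ (z₁ +i z₂) (w₁ +i w₂) (u₁ +i u₂) (v₁ +i v₂) = lemma z₁ z₂ w₁ w₂ u₁ u₂ v₁ v₂
  where
  lemma : ∀ z₁ z₂ w₁ w₂ u₁ u₂ v₁ v₂ →
          (z₁ - w₁) * v₂ - (z₂ - w₂) * v₁ ≡ ((z₁ - u₁) * v₂ - (z₂ - u₂) * v₁) - ((w₁ - u₁) * v₂ - (w₂ - u₂) * v₁)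
  lemma = solve-∀

cross-seqα : ∀ z δ m u v → cross (seqα z δ m ⊖ u) v ≡ cross (z ⊖ u) v + m * cross δ v
cross-seqα (z₁ +i z₂) (d₁ +i d₂) m (u₁ +i u₂) (v₁ +i v₂) = lemma z₁ z₂ d₁ d₂ m u₁ u₂ v₁ v₂
  where
  lemma : ∀ z₁ z₂ d₁ d₂ m u₁ u₂ v₁ v₂ →
          ((z₁ + m * d₁) - u₁) * v₂ - ((z₂ + m * d₂) - u₂) * v₁
          ≡ ((z₁ - u₁) * v₂ - (z₂ - u₂) * v₁) + m * (d₁ * v₂ - d₂ * v₁)
  lemma = solve-∀

cross-elim : ∀ x y w → re w * cross x y ≡ re y * cross x w - re x * cross y w
                     × im w * cross x y ≡ im y * cross x w - im x * cross y w
cross-elim (x₁ +i x₂) (y₁ +i y₂) (w₁ +i w₂) = re-elim x₁ x₂ y₁ y₂ w₁ w₂ , im-elim x₁ x₂ y₁ y₂ w₁ w₂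
  where
  re-elim : ∀ x₁ x₂ y₁ y₂ w₁ w₂ → w₁ * (x₁ * y₂ - x₂ * y₁) ≡ y₁ * (x₁ * w₂ - x₂ * w₁) - x₁ * (y₁ * w₂ - y₂ * w₁)
  re-elim = solve-∀
  im-elim : ∀ x₁ x₂ y₁ y₂ w₁ w₂ → w₂ * (x₁ * y₂ - x₂ * y₁) ≡ y₂ * (x₁ * w₂ - x₂ * w₁) - x₂ * (y₁ * w₂ - y₂ * w₁)
  im-elim = solve-∀

onLine-⊖ : ∀ {L z w} → OnLine L z → OnLine L w → z ⊖ w ∥ direction L
onLine-⊖ {L} {z} {w} z-on w-on = trans (cross-⊖ z w (p L) (direction L)) (cong₂ _-_ z-on w-on)

seqα-onLine : ∀ {L z δ} → OnLine L z → δ ∥ direction L → ∀ m → OnLine L (seqα z δ m)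
seqα-onLine {L} {z} {δ} z-on δ∥ m = begin
  cross (seqα z δ m ⊖ p L) (direction L)                     ≡⟨ cross-seqα z δ m (p L) (direction L) ⟩
  cross (z ⊖ p L) (direction L) + m * cross δ (direction L)  ≡⟨ cong₂ (λ u v → u + m * v) z-on δ∥ ⟩
  + 0 + m * + 0                                              ≡⟨ ℤᵖ.+-identityˡ (m * + 0) ⟩
  m * + 0                                                    ≡⟨ ℤᵖ.*-zeroʳ m ⟩
  + 0                                                        ∎
  where open ≡-Reasoning

annihilated : ∀ {w k} → w ≢ 0ᵍ → re w * k ≡ + 0 → im w * k ≡ + 0 → k ≡ + 0
annihilated {w₁ +i w₂} w≢0 w₁k≡0 w₂k≡0
  with ℤᵖ.i*j≡0⇒i≡0∨j≡0 w₁ w₁k≡0 | ℤᵖ.i*j≡0⇒i≡0∨j≡0 w₂ w₂k≡0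
... | inj₂ k≡0  | _         = k≡0
... | _         | inj₂ k≡0  = k≡0
... | inj₁ w₁≡0 | inj₁ w₂≡0 = ⊥-elim (w≢0 (cong₂ _+i_ w₁≡0 w₂≡0))

∥-trans : ∀ {x y w} → x ∥ w → y ∥ w → w ≢ 0ᵍ → x ∥ y
∥-trans {x} {y} {w} x∥w y∥w w≢0 =
  annihilated {w} w≢0 (vanishes re (proj₁ (cross-elim x y w))) (vanishes im (proj₂ (cross-elim x y w)))
  where
  vanishes : ∀ (f : 𝔾 → ℤ) → f w * cross x y ≡ f y * cross x w - f x * cross y w → f w * cross x y ≡ + 0
  vanishes f eq = trans eq (trans (cong₂ (λ s t → f y * s - f x * t) x∥w y∥w)
                                  (cong₂ _-_ (ℤᵖ.*-zeroʳ (f y)) (ℤᵖ.*-zeroʳ (f x))))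

δ∥direction : ∀ {L a δ} → OnLine L a → IsDelta L a δ → δ ∥ direction L
δ∥direction {L} _ (inj₁ (vertical , refl)) = lemma (re (p L)) (re (q L)) (im (p L)) (im (q L)) vertical
  where
  lemma : ∀ p₁ q₁ p₂ q₂ → p₁ ≡ q₁ → + 0 * (q₂ - p₂) - + 1 * (q₁ - p₁) ≡ + 0
  lemma p₁ _ p₂ q₂ refl = vanishes p₁ p₂ q₂
    where
    vanishes : ∀ p₁ p₂ q₂ → + 0 * (q₂ - p₂) - + 1 * (p₁ - p₁) ≡ + 0
    vanishes = solve-∀
δ∥direction {L} {a} a-on (inj₂ (_ , a₁ , a₁-on , _ , _ , refl)) = onLine-⊖ {L} {a₁} {a} a₁-on a-on

∥i⇒seqα : ∀ a z → z ⊖ a ∥ (+ 0) +i (+ 1) → z ≡ seqα a ((+ 0) +i (+ 1)) (im z - im a)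
∥i⇒seqα (a₁ +i a₂) (z₁ +i z₂) ∥i = cong₂ _+i_ re≡ (im≡ a₂ z₂)
  where
  cross-i : ∀ z₁ a₁ z₂ a₂ → (z₁ - a₁) * + 1 - (z₂ - a₂) * + 0 ≡ z₁ - a₁
  cross-i = solve-∀
  re≡ : z₁ ≡ a₁ + (z₂ - a₂) * + 0
  re≡ = trans (ℤᵖ.i-j≡0⇒i≡j z₁ a₁ (trans (sym (cross-i z₁ a₁ z₂ a₂)) ∥i))
              (sym (trans (cong (λ t → a₁ + t) (ℤᵖ.*-zeroʳ (z₂ - a₂))) (ℤᵖ.+-identityʳ a₁)))
  im≡ : ∀ a₂ z₂ → z₂ ≡ a₂ + (z₂ - a₂) * + 1
  im≡ = solve-∀

∥⇒N-proportional : ∀ {w δ} → w ∥ δ → (re δ * re δ) * N w ≡ (re w * re w) * N δ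
∥⇒N-proportional {w₁ +i w₂} {d₁ +i d₂} w∥δ = begin
  (d₁ * d₁) * (w₁ * w₁ + w₂ * w₂)               ≡⟨ expand w₁ w₂ d₁ ⟩
  (d₁ * d₁) * (w₁ * w₁) + (w₂ * d₁) * (w₂ * d₁)  ≡⟨ cong (λ t → (d₁ * d₁) * (w₁ * w₁) + t * t) w₂d₁≡w₁d₂ ⟩
  (d₁ * d₁) * (w₁ * w₁) + (w₁ * d₂) * (w₁ * d₂)  ≡⟨ collect w₁ d₁ d₂ ⟩
  (w₁ * w₁) * (d₁ * d₁ + d₂ * d₂)               ∎
  where
  open ≡-Reasoning
  w₂d₁≡w₁d₂ : w₂ * d₁ ≡ w₁ * d₂
  w₂d₁≡w₁d₂ = sym (ℤᵖ.i-j≡0⇒i≡j _ _ w∥δ)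
  expand : ∀ w₁ w₂ d₁ → (d₁ * d₁) * (w₁ * w₁ + w₂ * w₂) ≡ (d₁ * d₁) * (w₁ * w₁) + (w₂ * d₁) * (w₂ * d₁)
  expand = solve-∀
  collect : ∀ w₁ d₁ d₂ → (d₁ * d₁) * (w₁ * w₁) + (w₁ * d₂) * (w₁ * d₂) ≡ (w₁ * w₁) * (d₁ * d₁ + d₂ * d₂)
  collect = solve-∀

shorter-than-δ : ∀ {w δ r D} → w ∥ δ → re w ≡ + suc r → re δ ≡ + D → suc r < D → N w ℤ.< N δ
shorter-than-δ {w} {δ} {r} {D} w∥δ re-w re-δ r<D =
  ℤᵖ.*-cancelˡ-<-nonNeg (+ (D ℕ.* D)) (begin-strict
    + (D ℕ.* D) * N w          ≡⟨ scaled ⟩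
    + (suc r ℕ.* suc r) * N δ  <⟨ ℤᵖ.*-monoʳ-<-pos (N δ) (ℤ.+<+ r²<D²) ⟩
    + (D ℕ.* D) * N δ          ∎)
  where
  open ℤᵖ.≤-Reasoning
  square : ∀ {x n} → x ≡ + n → x * x ≡ + (n ℕ.* n)
  square {n = n} refl = sym (ℤᵖ.pos-* n n)
  scaled : + (D ℕ.* D) * N w ≡ + (suc r ℕ.* suc r) * N δ
  scaled = subst₂ (λ s t → s * N w ≡ t * N δ) (square re-δ) (square re-w) (∥⇒N-proportional {w} {δ} w∥δ)
  r²<D² : suc r ℕ.* suc r < D ℕ.* D
  r²<D² = ℕᵖ.*-mono-< r<D r<D
  0<N : + 0 ℤ.< N δ
  0<N = ℤᵖ.<-≤-trans (ℤ.+<+ (ℕᵖ.≤-<-trans z≤n r²<D²))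
          (subst (ℤ._≤ N δ) (trans (ℤᵖ.+-identityʳ _) (square re-δ)) (ℤᵖ.+-monoʳ-≤ (re δ * re δ) (0≤i*i (im δ))))
  instance
    _ : ℤ.Positive (N δ)
    _ = ℤ.positive 0<N

∥∧re≡0⇒≡0 : ∀ {w δ} → w ∥ δ → re w ≡ + 0 → re δ ≢ + 0 → w ≡ 0ᵍ
∥∧re≡0⇒≡0 {.(+ 0) +i w₂} {d₁ +i d₂} w∥δ refl d₁≢0 =
  [ cong ((+ 0) +i_) , ⊥-elim ∘ d₁≢0 ]′ (ℤᵖ.i*j≡0⇒i≡0∨j≡0 w₂ w₂d₁≡0)
  where
  cross≡ : ∀ w₂ d₁ d₂ → + 0 * d₂ - w₂ * d₁ ≡ - (w₂ * d₁)
  cross≡ = solve-∀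
  w₂d₁≡0 : w₂ * d₁ ≡ + 0
  w₂d₁≡0 = ℤᵖ.neg-injective (trans (sym (cross≡ w₂ d₁ d₂)) w∥δ)

0<i-j⇒j<i : ∀ {i j} → + 0 ℤ.< i - j → j ℤ.< i
0<i-j⇒j<i {i} {j} 0<i-j = subst₂ ℤ._<_ (ℤᵖ.+-identityˡ j) (cancel i j) (ℤᵖ.+-monoˡ-< j 0<i-j)
  where
  cancel : ∀ i j → (i - j) + j ≡ i
  cancel = solve-∀

seqα-back : ∀ a z δ m → seqα z δ (- m) ⊖ a ≡ 0ᵍ → z ≡ seqα a δ m
seqα-back (a₁ +i a₂) (z₁ +i z₂) (d₁ +i d₂) m eq = cong₂ _+i_ (coordinate (cong re eq)) (coordinate (cong im eq))
  where
  split : ∀ z a m d → z ≡ (a + m * d) + ((z + - m * d) - a)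
  split = solve-∀
  coordinate : ∀ {z a d} → (z + - m * d) - a ≡ + 0 → z ≡ a + m * d
  coordinate {z} {a} {d} eq′ = trans (split z a m d) (trans (cong (λ t → (a + m * d) + t) eq′) (ℤᵖ.+-identityʳ _))

-- Dividing re (z - a) by re δ with remainder r: the minimality of δ forces r = 0.
onLine⇒seqα-nonvertical : ∀ {L a δ D} → OnLine L a → δ ∥ direction L → re δ ≡ + suc D →
  (∀ z → OnLine L z → re a ℤ.< re z → N δ ℤ.≤ N (z ⊖ a)) →
  ∀ {z} → OnLine L z → ∃ λ m → z ≡ seqα a δ m
onLine⇒seqα-nonvertical {L} {a} {δ} {D} a-on δ∥ re-δ closest {z} z-on =
  m , seqα-back a z δ m (∥∧re≡0⇒≡0 {w} {δ} w∥δ (subst (λ r → re w ≡ + r) r≡0 re-w) re-δ≢0)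
  where
  x = re z - re a
  m = x /ℕ suc D
  r = x %ℕ suc D
  z′ = seqα z δ (- m)
  w = z′ ⊖ a
  z′-on : OnLine L z′
  z′-on = seqα-onLine {L} {z} {δ} z-on δ∥ (- m)
  w∥δ : w ∥ δ
  w∥δ = ∥-trans {w} {δ} (onLine-⊖ {L} {z′} {a} z′-on a-on) δ∥ (direction≢0 L)
  re-w : re w ≡ + r
  re-w = begin
    (re z + - m * re δ) - re a     ≡⟨ regroup (re z) (re a) m (re δ) ⟩
    x - m * re δ                   ≡⟨ cong₂ (λ s t → s - m * t) (a≡a%ℕn+[a/ℕn]*n x (suc D)) re-δ ⟩
    (+ r + m * + suc D) - m * + suc D  ≡⟨ cancel (+ r) (m * + suc D) ⟩
    + r                            ∎
    where
    open ≡-Reasoning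
    regroup : ∀ z a m d → (z + - m * d) - a ≡ (z - a) - m * d
    regroup = solve-∀
    cancel : ∀ u v → (u + v) - v ≡ u
    cancel = solve-∀
  remainder≡0 : ∀ {s} → re w ≡ + s → s < suc D → s ≡ 0
  remainder≡0 {zero} _ _ = refl
  remainder≡0 {suc s} re-w s<D = ⊥-elim (ℤᵖ.<⇒≱ (shorter-than-δ {w} {δ} w∥δ re-w re-δ s<D)
    (closest z′ z′-on (0<i-j⇒j<i (subst (+ 0 ℤ.<_) (sym re-w) (ℤ.+<+ (s≤s z≤n))))))
  r≡0 : r ≡ 0
  r≡0 = remainder≡0 re-w (n%ℕd<d x (suc D))
  re-δ≢0 : re δ ≢ + 0
  re-δ≢0 eq with () ← trans (sym re-δ) eq

j<i⇒0<i-j : ∀ {i j} → j ℤ.< i → + 0 ℤ.< i - j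
j<i⇒0<i-j {i} {j} j<i = subst (ℤ._< i - j) (ℤᵖ.+-inverseʳ j) (ℤᵖ.+-monoˡ-< (- j) j<i)

0<⇒≡+suc : ∀ {i} → + 0 ℤ.< i → ∃ λ n → i ≡ + suc n
0<⇒≡+suc {+[1+ n ]} _ = n , refl
0<⇒≡+suc {+ zero} (ℤ.+<+ ())

onLine⇒seqα : ∀ {L a δ} → IsAlpha0 L a → IsDelta L a δ → ∀ {z} → OnLine L z → ∃ λ m → z ≡ seqα a δ m
onLine⇒seqα {L} {a} (a-on , _) isδ@(inj₁ (_ , refl)) {z} z-on =
  im z - im a ,
  ∥i⇒seqα a z (∥-trans {z ⊖ a} (onLine-⊖ {L} {z} {a} z-on a-on) (δ∥direction {L} {a} a-on isδ) (direction≢0 L))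
onLine⇒seqα {L} {a} (a-on , _) isδ@(inj₂ (_ , a₁ , _ , a<a₁ , closest , refl)) =
  onLine⇒seqα-nonvertical {L} {a} {a₁ ⊖ a} a-on (δ∥direction {L} {a} a-on isδ) re-δ closest
  where re-δ = proj₂ (0<⇒≡+suc (j<i⇒0<i-j a<a₁))

-- Common divisors of terms of the sequence

·-combination : ∀ s t u v x → s · (u · x) ⊕ t · (v · x) ≡ (s * u + t * v) · x
·-combination s t u v (x₁ +i x₂) = cong₂ _+i_ (lemma s t u v x₁) (lemma s t u v x₂)
  where
  lemma : ∀ s t u v x → s * (u * x) + t * (v * x) ≡ (s * u + t * v) * x
  lemma = solve-∀

·-identityˡ : ∀ x → (+ 1) · x ≡ x
·-identityˡ (x₁ +i x₂) = cong₂ _+i_ (ℤᵖ.*-identityˡ x₁) (ℤᵖ.*-identityˡ x₂)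

1+m≡n⇒+n-+m≡1 : ∀ {m n} → 1 ℕ.+ m ≡ n → + n - + m ≡ + 1
1+m≡n⇒+n-+m≡1 {m} refl = trans (cong (_- + m) (ℤᵖ.pos-+ 1 m)) (cancel (+ 1) (+ m))
  where
  cancel : ∀ u v → (u + v) - v ≡ u
  cancel = solve-∀

coprime⇒Bézout : ∀ {n k} → ℕᶜ.Coprime n k → ∃ λ s → ∃ λ t → s * + n + t * + k ≡ + 1
coprime⇒Bézout {n} {k} n⊥k = fromIdentity (ℕᶜ.coprime-Bézout n⊥k)
  where
  difference≡1 : ∀ a b c d → 1 ℕ.+ c ℕ.* d ≡ a ℕ.* b → + a * + b - + c * + d ≡ + 1
  difference≡1 a b c d eq = trans (cong₂ _-_ (sym (ℤᵖ.pos-* a b)) (sym (ℤᵖ.pos-* c d))) (1+m≡n⇒+n-+m≡1 eq)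
  swap : ∀ a b c d → - a * b + c * d ≡ c * d - a * b
  swap = solve-∀
  fromIdentity : Identity 1 n k → ∃ λ s → ∃ λ t → s * + n + t * + k ≡ + 1
  fromIdentity (+- u v 1+vk≡un) = + u , - + v ,
    trans (cong (λ t → + u * + n + t) (sym (ℤᵖ.neg-distribˡ-* (+ v) (+ k)))) (difference≡1 u n v k 1+vk≡un)
  fromIdentity (-+ u v 1+un≡vk) = - + u , + v , trans (swap (+ u) (+ n) (+ v) (+ k)) (difference≡1 v k u n 1+un≡vk)

∣n⇒∣k·x⇒∣x : ∀ {d x n k} → d ∣ ι (+ n) → ℕᶜ.Coprime n k → d ∣ ((+ k) · x) → d ∣ x
∣n⇒∣k·x⇒∣x {d} {x} {n} {k} d∣n n⊥k d∣kx =
  ∣-resp-≡ {d} (trans (·-combination s t (+ n) (+ k) x) (trans (cong (_· x) sn+tk≡1) (·-identityˡ x)))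
               (∣x∣y⇒∣x⊕y {d} (∣x⇒∣m·x {d} s d∣nx) (∣x⇒∣m·x {d} t d∣kx))
  where
  s = proj₁ (coprime⇒Bézout n⊥k)
  t = proj₁ (proj₂ (coprime⇒Bézout n⊥k))
  sn+tk≡1 = proj₂ (proj₂ (coprime⇒Bézout n⊥k))
  d∣nx : d ∣ ((+ n) · x)
  d∣nx = ∣ι⇒∣· {d} x d∣n

seqα-gap : ∀ a δ m g → seqα a δ (m + g) ⊖ seqα a δ m ≡ g · δ
seqα-gap (a₁ +i a₂) (d₁ +i d₂) m g = cong₂ _+i_ (lemma a₁ d₁ m g) (lemma a₂ d₂ m g)
  where
  lemma : ∀ a d m g → (a + (m + g) * d) - (a + m * d) ≡ g * d
  lemma = solve-∀

seqα-start : ∀ a δ m g → g · seqα a δ m ⊖ m · (g · δ) ≡ g · a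
seqα-start (a₁ +i a₂) (d₁ +i d₂) m g = cong₂ _+i_ (lemma a₁ d₁ m g) (lemma a₂ d₂ m g)
  where
  lemma : ∀ a d m g → g * (a + m * d) - m * (g * d) ≡ g * a
  lemma = solve-∀

-- d divides g·δ and g·α₀, and a multiple n of d coprime to g lets us cancel g.
∣seqα∧∣seqα⇒isUnit : ∀ {a δ d n g} m → Coprime a δ → d ∣ ι (+ n) → ℕᶜ.Coprime n g →
                      d ∣ seqα a δ m → d ∣ seqα a δ (m + + g) → IsUnit d
∣seqα∧∣seqα⇒isUnit {a} {δ} {d} {n} {g} m a⊥δ d∣n n⊥g d∣αm d∣αm+g = a⊥δ d d∣a d∣δ
  where
  d∣gδ : d ∣ ((+ g) · δ)
  d∣gδ = ∣-resp-≡ {d} (seqα-gap a δ m (+ g)) (∣x∣y⇒∣x⊖y {d} d∣αm+g d∣αm)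
  d∣δ : d ∣ δ
  d∣δ = ∣n⇒∣k·x⇒∣x {d} d∣n n⊥g d∣gδ
  d∣a : d ∣ a
  d∣a = ∣n⇒∣k·x⇒∣x {d} d∣n n⊥g
          (∣-resp-≡ {d} (seqα-start a δ m (+ g)) (∣x∣y⇒∣x⊖y {d} (∣x⇒∣m·x {d} (+ g) d∣αm) (∣x⇒∣m·x {d} m d∣gδ)))

primitive⇒coprime : ∀ {L a δ} → Primitive L → IsAlpha0 L a → IsDelta L a δ → Coprime a δ
primitive⇒coprime {L} {a} {δ} (z , w , z-on , w-on , z⊥w) isα isδ d d∣a d∣δ
  with onLine⇒seqα {L} {a} {δ} isα isδ {z} z-on | onLine⇒seqα {L} {a} {δ} isα isδ {w} w-on
... | m , refl | m′ , refl = z⊥w d (∣seqα m) (∣seqα m′)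
  where
  ∣seqα : ∀ m → d ∣ seqα a δ m
  ∣seqα m = ∣x∣y⇒∣x⊕y {d} d∣a (∣x⇒∣m·x {d} m d∣δ)

seqα-shift : ∀ a δ m k → seqα a δ (m + k) ≡ seqα a δ m ⊕ k · δ
seqα-shift (a₁ +i a₂) (d₁ +i d₂) m k = cong₂ _+i_ (lemma a₁ d₁ m k) (lemma a₂ d₂ m k)
  where
  lemma : ∀ a d m k → a + (m + k) * d ≡ (a + m * d) + k * d
  lemma = solve-∀

*-·-assoc : ∀ s t x → (s * t) · x ≡ s · (t · x)
*-·-assoc s t (x₁ +i x₂) = cong₂ _+i_ (ℤᵖ.*-assoc s t x₁) (ℤᵖ.*-assoc s t x₂)

∣seqα-periodic : ∀ {a δ d n} m k → d ∣ ι (+ n) → d ∣ seqα a δ m → d ∣ seqα a δ (m + k * + n)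
∣seqα-periodic {a} {δ} {d} {n} m k d∣n d∣αm =
  ∣-resp-≡ {d} (sym (seqα-shift a δ m (k * + n)))
    (∣x∣y⇒∣x⊕y {d} d∣αm (∣-resp-≡ {d} (sym (*-·-assoc k (+ n) δ)) (∣x⇒∣m·x {d} k (∣ι⇒∣· {d} δ d∣n))))

∣seqα-congruent : ∀ {a δ d n m m′} → d ∣ ι (+ n) → + n ∣ℤ (m′ - m) → d ∣ seqα a δ m → d ∣ seqα a δ m′
∣seqα-congruent {a} {δ} {d} {n} {m} {m′} d∣n (divides k m′-m≡kn) d∣αm =
  subst (λ t → d ∣ seqα a δ t) m+kn≡m′ (∣seqα-periodic {a} {δ} {d} m k d∣n d∣αm)
  where
  split : ∀ m m′ → m′ ≡ m + (m′ - m)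
  split = solve-∀
  m+kn≡m′ : m + k * + n ≡ m′
  m+kn≡m′ = sym (trans (split m m′) (cong (λ t → m + t) m′-m≡kn))

-- The Gaussian primes above 2, 3 and 5

data SmallPrime : Set where
  two three five five′ : SmallPrime

π : SmallPrime → 𝔾
π two   = 1+i
π three = 3ᵍ
π five  = 1+2i
π five′ = 1-2i

rationalPrime : SmallPrime → ℕ
rationalPrime two   = 2
rationalPrime three = 3
rationalPrime five  = 5
rationalPrime five′ = 5

instance
  rationalPrime-nonZero : ∀ {P} → NonZero (rationalPrime P)
  rationalPrime-nonZero {two}   = _
  rationalPrime-nonZero {three} = _
  rationalPrime-nonZero {five}  = _
  rationalPrime-nonZero {five′} = _

-- The other prime above the same rational prime (1-i is an associate of 1+i).
conjugate : SmallPrime → SmallPrime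
conjugate five  = five′
conjugate five′ = five
conjugate P     = P

rationalPrime-prime : ∀ P → Prime (rationalPrime P)
rationalPrime-prime two   = prime[2]
rationalPrime-prime three = from-yes (prime? 3)
rationalPrime-prime five  = from-yes (prime? 5)
rationalPrime-prime five′ = from-yes (prime? 5)

π∣rationalPrime : ∀ P → π P ∣ ι (+ rationalPrime P)
π∣rationalPrime two   = (+ 1) +i (- + 1) , refl
π∣rationalPrime three = ι (+ 1) , refl
π∣rationalPrime five  = 1-2i , refl
π∣rationalPrime five′ = 1+2i , refl

π-conjugate∣rationalPrime : ∀ P → π (conjugate P) ∣ ι (+ rationalPrime P)
π-conjugate∣rationalPrime two   = π∣rationalPrime two
π-conjugate∣rationalPrime three = π∣rationalPrime three
π-conjugate∣rationalPrime five  = π∣rationalPrime five′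
π-conjugate∣rationalPrime five′ = π∣rationalPrime five

π-nonUnit : ∀ P → ¬ IsUnit (π P)
π-nonUnit P = N-π∤1 P ∘ N-mono-∣ {π P}
  where
  N-π∤1 : ∀ P → ¬ N (π P) ∣ℤ + 1
  N-π∤1 two   = from-no (+ 2 ∣? + 1)
  N-π∤1 three = from-no (+ 9 ∣? + 1)
  N-π∤1 five  = from-no (+ 5 ∣? + 1)
  N-π∤1 five′ = from-no (+ 5 ∣? + 1)

N-π≢0 : ∀ P → N (π P) ≢ + 0
N-π≢0 two   ()
N-π≢0 three ()
N-π≢0 five  ()
N-π≢0 five′ ()

_π∣?_ : ∀ P z → Dec (π P ∣ z)
P π∣? z = ∣-dec {π P} (N-π≢0 P) z

reduce : (n : ℕ) .{{_ : NonZero n}} → 𝔾 → 𝔾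
reduce n (x +i y) = (+ (x %ℕ n)) +i (+ (y %ℕ n))

quotient : (n : ℕ) .{{_ : NonZero n}} → 𝔾 → 𝔾
quotient n (x +i y) = (x /ℕ n) +i (y /ℕ n)

reduce-split : ∀ n .{{_ : NonZero n}} z → z ≡ reduce n z ⊕ (+ n) · quotient n z
reduce-split n (x +i y) = cong₂ _+i_ (split x) (split y)
  where
  split : ∀ x → x ≡ + (x %ℕ n) + + n * (x /ℕ n)
  split x = trans (a≡a%ℕn+[a/ℕn]*n x n) (cong (λ t → + (x %ℕ n) + t) (ℤᵖ.*-comm (x /ℕ n) (+ n)))

∣reduce⇒∣ : ∀ {d n} .{{_ : NonZero n}} z → d ∣ ι (+ n) → d ∣ reduce n z → d ∣ z
∣reduce⇒∣ {d} {n} z d∣n d∣r =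
  ∣-resp-≡ {d} (sym (reduce-split n z)) (∣x∣y⇒∣x⊕y {d} d∣r (∣ι⇒∣· {d} (quotient n z) d∣n))

∣N⇒∣N-reduce : ∀ {n} .{{_ : NonZero n}} z → + n ∣ℤ N z → + n ∣ℤ N (reduce n z)
∣N⇒∣N-reduce {n} z n∣Nz = ∣m+n∣n⇒∣m (subst (+ n ∣ℤ_) (N-split (reduce n z) (quotient n z) (+ n)) n∣Nz′)
                                     (divides (cofactor (reduce n z) (quotient n z) (+ n)) refl)
  where
  n∣Nz′ : + n ∣ℤ N (reduce n z ⊕ (+ n) · quotient n z)
  n∣Nz′ = subst (λ w → + n ∣ℤ N w) (reduce-split n z) n∣Nz
  cofactor : 𝔾 → 𝔾 → ℤ → ℤ
  cofactor r q m = re q * (re r + re r + m * re q) + im q * (im r + im r + m * im q)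
  N-split : ∀ r q m → N (r ⊕ m · q) ≡ N r + cofactor r q m * m
  N-split (r₁ +i r₂) (q₁ +i q₂) m = lemma r₁ r₂ q₁ q₂ m
    where
    lemma : ∀ r₁ r₂ q₁ q₂ m → (r₁ + m * q₁) * (r₁ + m * q₁) + (r₂ + m * q₂) * (r₂ + m * q₂)
                              ≡ (r₁ * r₁ + r₂ * r₂) + (q₁ * (r₁ + r₁ + m * q₁) + q₂ * (r₂ + r₂ + m * q₂)) * m
    lemma = solve-∀

residueTable : ∀ P → let n = rationalPrime P in
  T (all (λ r → all (λ s → isYes ((+ n ∣? N ((+ r) +i (+ s))) →-dec
                                  ((P π∣? ((+ r) +i (+ s))) ⊎-dec (conjugate P π∣? ((+ r) +i (+ s))))))
              (upTo n)) (upTo n))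
residueTable two   = _
residueTable three = _
residueTable five  = _
residueTable five′ = _

-- Both sides only depend on z modulo p, so a check of all residues decides it.
∣N⇒π∣ : ∀ P z → + rationalPrime P ∣ℤ N z → (π P ∣ z) ⊎ (π (conjugate P) ∣ z)
∣N⇒π∣ P z p∣Nz =
  Sum.map (∣reduce⇒∣ {π P} z (π∣rationalPrime P)) (∣reduce⇒∣ {π (conjugate P)} z (π-conjugate∣rationalPrime P))
  (toWitness (T-all-upTo (T-all-upTo (residueTable P) (n%ℕd<d (re z) n)) (n%ℕd<d (im z) n)) (∣N⇒∣N-reduce z p∣Nz))
  where n = rationalPrime P

∣ι∣N∣ : ∀ d → d ∣ ι (+ ℤ.∣ N d ∣)
∣ι∣N∣ d = subst (λ n → d ∣ ι n) (sym (ℤᵖ.0≤i⇒+∣i∣≡i (0≤N d))) (∣ι-N d)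

coprime-to-small : ∀ {n g} → ¬ 2 ∣ℕ n → ¬ 3 ∣ℕ n → ¬ 5 ∣ℕ n → 1 ≤ g → g ≤ 6 → ℕᶜ.Coprime n g
coprime-to-small {n} {suc g} 2∤n 3∤n 5∤n (s≤s z≤n) g≤6 {i} (i∣n , i∣g) =
  divisor≡1 i i∣n i∣g (ℕᵖ.≤-trans (ℕᵈ.∣⇒≤ i∣g) g≤6)
  where
  divisor≡1 : ∀ i → i ∣ℕ n → i ∣ℕ suc g → i ≤ 6 → i ≡ 1
  divisor≡1 0 _ 0∣g _ with () ← ℕᵈ.0∣⇒≡0 0∣g
  divisor≡1 1 _ _ _ = refl
  divisor≡1 2 2∣n _ _ = ⊥-elim (2∤n 2∣n)
  divisor≡1 3 3∣n _ _ = ⊥-elim (3∤n 3∣n)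
  divisor≡1 4 4∣n _ _ = ⊥-elim (2∤n (ℕᵈ.∣-trans (ℕᵈ.divides 2 refl) 4∣n))
  divisor≡1 5 5∣n _ _ = ⊥-elim (5∤n 5∣n)
  divisor≡1 6 6∣n _ _ = ⊥-elim (2∤n (ℕᵈ.∣-trans (ℕᵈ.divides 3 refl) 6∣n))
  divisor≡1 (suc (suc (suc (suc (suc (suc (suc _))))))) _ _ (s≤s (s≤s (s≤s (s≤s (s≤s (s≤s ()))))))

∣N⇒∃π∣ : ∀ {d} P → rationalPrime P ∣ℕ ℤ.∣ N d ∣ → ∃ λ Q → π Q ∣ d
∣N⇒∃π∣ {d} P p∣Nd = [ (P ,_) , (conjugate P ,_) ]′ (∣N⇒π∣ P d (∣ᵤ⇒∣ p∣Nd))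

-- If none of 2, 3, 5 divides N d, then N d is coprime to the gap.
nonUnit∣seqα⇒π∣ : ∀ {a δ d g} m → Coprime a δ → ¬ IsUnit d →
                  d ∣ seqα a δ m → d ∣ seqα a δ (m + + g) → 1 ≤ g → g ≤ 6 → ∃ λ P → π P ∣ d
nonUnit∣seqα⇒π∣ {d = d} m a⊥δ d-nonUnit d∣αm d∣αm+g 1≤g g≤6
  with 2 ∣ℕ? ℤ.∣ N d ∣ | 3 ∣ℕ? ℤ.∣ N d ∣ | 5 ∣ℕ? ℤ.∣ N d ∣
... | yes 2∣Nd | _        | _        = ∣N⇒∃π∣ {d} two 2∣Nd
... | no _     | yes 3∣Nd | _        = ∣N⇒∃π∣ {d} three 3∣Nd
... | no _     | no _     | yes 5∣Nd = ∣N⇒∃π∣ {d} five 5∣Nd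
... | no 2∤Nd  | no 3∤Nd  | no 5∤Nd  =
  ⊥-elim (d-nonUnit (∣seqα∧∣seqα⇒isUnit {d = d} m a⊥δ (∣ι∣N∣ d) (coprime-to-small 2∤Nd 3∤Nd 5∤Nd 1≤g g≤6)
                                          d∣αm d∣αm+g))

prime∤⇒coprime : ∀ {p g} → Prime p → ¬ p ∣ℕ g → ℕᶜ.Coprime p g
prime∤⇒coprime {p} {g} p-prime p∤g {i} (i∣p , i∣g) =
  [ (λ i≡1 → i≡1) , (λ i≡p → ⊥-elim (p∤g (subst (_∣ℕ g) i≡p i∣g))) ]′ (prime⇒irreducible p-prime i∣p)

π∣seqα⇒∣gap : ∀ {a δ} P m {g} → Coprime a δ → π P ∣ seqα a δ m → π P ∣ seqα a δ (m + + g) → rationalPrime P ∣ℕ g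
π∣seqα⇒∣gap P m {g} a⊥δ π∣αm π∣αm+g = decidable-stable (rationalPrime P ∣ℕ? g) λ p∤g →
  π-nonUnit P (∣seqα∧∣seqα⇒isUnit {d = π P} m a⊥δ (π∣rationalPrime P) (prime∤⇒coprime (rationalPrime-prime P) p∤g)
                                   π∣αm π∣αm+g)

-- Divisibility patterns on a block of seven consecutive positions

-- M P i: the prime P divides the term at position i of the block.
Marking : Set
Marking = SmallPrime → ℕ → Bool

Covered : ℕ → Marking → Set
Covered n M = ∀ {i} → i < n → ∃ λ j → j < n × i ≢ j × ∃ λ P → T (M P i) × T (M P j)

smallPrimes : List SmallPrime
smallPrimes = two ∷ three ∷ five ∷ five′ ∷ []

∈-smallPrimes : ∀ P → P ∈ smallPrimes
∈-smallPrimes two   = here refl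
∈-smallPrimes three = there (here refl)
∈-smallPrimes five  = there (there (here refl))
∈-smallPrimes five′ = there (there (there (here refl)))

covered : ℕ → Marking → Bool
covered n M =
  all (λ i → any (λ j → isYes (¬? (i ℕ.≟ j)) ∧ any (λ P → M P i ∧ M P j) smallPrimes) (upTo n)) (upTo n)

Covered⇒covered : ∀ {n M} → Covered n M → T (covered n M)
Covered⇒covered {n} {M} cov = all-upTo⁺ λ {i} i<n →
  let j , j<n , i≢j , P , Mi , Mj = cov i<n in
  any-upTo⁺ j<n (Equivalence.from Boolᵖ.T-∧ (fromWitness {a? = ¬? (i ℕ.≟ j)} i≢j ,
    any⁺ (λ P → M P i ∧ M P j)
         (lose {P = λ P → T (M P i ∧ M P j)} (∈-smallPrimes P) (Equivalence.from Boolᵖ.T-∧ (Mi , Mj)))))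

covered⇒Covered : ∀ {n M} → T (covered n M) → Covered n M
covered⇒Covered {n} {M} cov {i} i<n =
  let j , j<n , shared = T-any-upTo (T-all-upTo cov i<n)
      i≢j , some-P = Equivalence.to Boolᵖ.T-∧ shared
      P , _ , Mi∧Mj = find (any⁻ (λ P → M P i ∧ M P j) smallPrimes some-P) in
  j , j<n , toWitness {a? = ¬? (i ℕ.≟ j)} i≢j , P , Equivalence.to Boolᵖ.T-∧ Mi∧Mj

_at_ : ∀ {n} → Vec Bool n → ℕ → Bool
[]      at _     = Bool.false
(b ∷ v) at zero  = b
(b ∷ v) at suc i = v at i

at-tabulate : ∀ {n} (f : ℕ → Bool) {i} → i < n → tabulate {n = n} (f ∘ toℕ) at i ≡ f i
at-tabulate {suc n} f {zero}  _         = refl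
at-tabulate {suc n} f {suc i} (s≤s i<n) = at-tabulate {n} (f ∘ suc) i<n

residueClass : SmallPrime → ℕ → Vec Bool 7
residueClass P r = tabulate λ i → isYes (toℕ i % rationalPrime P ℕ.≟ r)

classes : SmallPrime → List (Vec Bool 7)
classes P = replicate 7 Bool.false ∷ map (residueClass P) (upTo (rationalPrime P))

separated? : ∀ P (v : Vec Bool 7) i j → Dec (T (v at i) × T (v at j) → i % rationalPrime P ≡ j % rationalPrime P)
separated? P v i j = (T? (v at i) ×-dec T? (v at j)) →-dec (i % rationalPrime P ℕ.≟ j % rationalPrime P)

periodic? : ∀ P (v : Vec Bool 7) i → Dec ((T (v at i) → T (v at (i ℕ.+ rationalPrime P)))
                                         × (T (v at (i ℕ.+ rationalPrime P)) → T (v at i)))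
periodic? P v i = (T? (v at i) →-dec T? (v at (i ℕ.+ n))) ×-dec (T? (v at (i ℕ.+ n)) →-dec T? (v at i))
  where n = rationalPrime P

valid : SmallPrime → Vec Bool 7 → Bool
valid P v = all (λ i → all (λ j → isYes (separated? P v i j)) (upTo 7)) (upTo 7)
          ∧ all (λ i → isYes (periodic? P v i)) (upTo (7 ∸ rationalPrime P))

Valid : SmallPrime → Vec Bool 7 → Set
Valid P v = (∀ {i j} → i < 7 → j < 7 → T (v at i) × T (v at j) → i % n ≡ j % n)
          × (∀ {i} → i < 7 ∸ n → (T (v at i) → T (v at (i ℕ.+ n))) × (T (v at (i ℕ.+ n)) → T (v at i)))
  where n = rationalPrime P

Valid⇒valid : ∀ P {v} → Valid P v → T (valid P v)
Valid⇒valid P {v} (congruent , periodic) = Equivalence.from Boolᵖ.T-∧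
  ( all-upTo⁺ {f = λ i → all (λ j → isYes (separated? P v i j)) (upTo 7)} (λ {i} i<7 →
      all-upTo⁺ {f = λ j → isYes (separated? P v i j)} λ {j} j<7 →
        fromWitness {a? = separated? P v i j} (congruent i<7 j<7))
  , all-upTo⁺ {f = λ i → isYes (periodic? P v i)} λ {i} i<7-n →
      fromWitness {a? = periodic? P v i} (periodic i<7-n))

open DecMembership (≡-dec {n = 7} Boolᵖ._≟_) using (_∈?_)

noInvalidColumn : ∀ P → ¬ ∃ λ v → T (valid P v) × ¬ v ∈ classes P
noInvalidColumn two   = from-no (anySubset? {n = 7} λ v → T? (valid two v) ×-dec ¬? (v ∈? classes two))
noInvalidColumn three = from-no (anySubset? {n = 7} λ v → T? (valid three v) ×-dec ¬? (v ∈? classes three))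
noInvalidColumn five  = from-no (anySubset? {n = 7} λ v → T? (valid five v) ×-dec ¬? (v ∈? classes five))
noInvalidColumn five′ = from-no (anySubset? {n = 7} λ v → T? (valid five′ v) ×-dec ¬? (v ∈? classes five′))

valid⇒∈classes : ∀ P {v} → T (valid P v) → v ∈ classes P
valid⇒∈classes P {v} v-valid = decidable-stable (v ∈? classes P) λ v∉ → noInvalidColumn P (v , v-valid , v∉)

Pattern : Set
Pattern = Vec Bool 7 × Vec Bool 7 × Vec Bool 7 × Vec Bool 7

marking : Pattern → Marking
marking (v₂ , v₃ , v₅ , v₅′) two   = v₂ at_
marking (v₂ , v₃ , v₅ , v₅′) three = v₃ at_
marking (v₂ , v₃ , v₅ , v₅′) five  = v₅ at_
marking (v₂ , v₃ , v₅ , v₅′) five′ = v₅′ at_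

classPatterns : List Pattern
classPatterns =
  cartesianProduct (classes two)
    (cartesianProduct (classes three) (cartesianProduct (classes five) (classes five′)))

adjacentFives : Marking → ℕ → Bool
adjacentFives M i = (M five i ∧ M five′ (suc i)) ∨ (M five′ i ∧ M five (suc i))

condition7 : Marking → Bool
condition7 M = any (M two) (upTo 7) ∧ any (M three) (upTo 7) ∧ any (adjacentFives M) (upTo 6)

Condition7 : Marking → Set
Condition7 M = (∃ λ i → i < 7 × T (M two i)) × (∃ λ i → i < 7 × T (M three i))
             × ∃ λ i → i < 6 × ((T (M five i) × T (M five′ (suc i))) ⊎ (T (M five′ i) × T (M five (suc i))))

T-∧⁻ : ∀ x {y} → T (x ∧ y) → T x × T y
T-∧⁻ x = Equivalence.to (Boolᵖ.T-∧ {x})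

condition7⇒Condition7 : ∀ {M} → T (condition7 M) → Condition7 M
condition7⇒Condition7 {M} c7 =
  let some₂ , rest = T-∧⁻ (any (M two) (upTo 7)) c7
      some₃ , adjacent = T-∧⁻ (any (M three) (upTo 7)) rest
      i , i<6 , fives = T-any-upTo {f = adjacentFives M} adjacent
  in T-any-upTo {f = M two} some₂ , T-any-upTo {f = M three} some₃ , i , i<6 ,
     Sum.map (T-∧⁻ (M five i)) (T-∧⁻ (M five′ i)) (Equivalence.to (Boolᵖ.T-∨ {M five i ∧ M five′ (suc i)}) fives)

classPatternCheck : Pattern → Bool
classPatternCheck V = all (λ n → not (covered (suc n) (marking V))) (upTo 6)
                    ∧ (not (covered 7 (marking V)) ∨ condition7 (marking V))

exhaustive : T (all classPatternCheck classPatterns)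
exhaustive = _

T-not⇒¬T : ∀ {b} → T (not b) → ¬ T b
T-not⇒¬T {Bool.false} _ ()

module _ {V : Pattern} (V∈ : V ∈ classPatterns) where

  private
    checked : T (all (λ n → not (covered (suc n) (marking V))) (upTo 6))
            × T (not (covered 7 (marking V)) ∨ condition7 (marking V))
    checked = Equivalence.to Boolᵖ.T-∧ (All.lookup (all⁺ classPatternCheck classPatterns exhaustive) V∈)

  classPattern-uncovered : ∀ {n} → 1 ≤ n → n ≤ 6 → ¬ Covered n (marking V)
  classPattern-uncovered {suc n} _ n<6 cov =
    T-not⇒¬T (T-all-upTo {f = λ n → not (covered (suc n) (marking V))} (proj₁ checked) n<6) (Covered⇒covered cov)

  classPattern-covered⇒Condition7 : Covered 7 (marking V) → Condition7 (marking V)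
  classPattern-covered⇒Condition7 cov = condition7⇒Condition7 {marking V}
    ([ (λ uncovered → ⊥-elim (T-not⇒¬T uncovered (Covered⇒covered cov))) , (λ c → c) ]′
     (Equivalence.to Boolᵖ.T-∨ (proj₂ checked)))

-- The pattern of a good block of seven: 1+i at even positions, 3 at multiples of 3, and the two
-- primes above 5 at positions 0, 5 and 1, 6.
goodPattern : ℕ → ℕ → Pattern
goodPattern r₅ r₅′ = residueClass two 0 , residueClass three 0 , residueClass five r₅ , residueClass five′ r₅′

goodPattern-covered : T (covered 7 (marking (goodPattern 0 1))) × T (covered 7 (marking (goodPattern 1 0)))
goodPattern-covered = _ , _

-- 15, 10 and 6 are 1 modulo 2, 3 and 5 respectively, and 0 modulo the other two.
crt : ∀ m₂ m₃ m₅ → ∃ λ s → + 2 ∣ℤ (+ s - m₂) × + 3 ∣ℤ (+ s - m₃) × + 5 ∣ℤ (+ s - m₅)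
crt m₂ m₃ m₅ = s
  , divides (+ 7 * m₂ + + 5 * m₃ + + 3 * m₅ - + 15 * k) (trans (cong (_- m₂) s≡) (mod2 m₂ m₃ m₅ k))
  , divides (+ 5 * m₂ + + 3 * m₃ + + 2 * m₅ - + 10 * k) (trans (cong (_- m₃) s≡) (mod3 m₂ m₃ m₅ k))
  , divides (+ 3 * m₂ + + 2 * m₃ + m₅ - + 6 * k) (trans (cong (_- m₅) s≡) (mod5 m₂ m₃ m₅ k))
  where
  x = + 15 * m₂ + + 10 * m₃ + + 6 * m₅
  s = x %ℕ 30
  k = x /ℕ 30
  s≡ : + s ≡ x - k * + 30
  s≡ = trans (solve₁ (+ s) (k * + 30)) (cong (_- k * + 30) (sym (a≡a%ℕn+[a/ℕn]*n x 30)))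
    where
    solve₁ : ∀ u v → u ≡ (u + v) - v
    solve₁ = solve-∀
  mod2 : ∀ m₂ m₃ m₅ k → ((+ 15 * m₂ + + 10 * m₃ + + 6 * m₅) - k * + 30) - m₂
                       ≡ (+ 7 * m₂ + + 5 * m₃ + + 3 * m₅ - + 15 * k) * + 2
  mod2 = solve-∀
  mod3 : ∀ m₂ m₃ m₅ k → ((+ 15 * m₂ + + 10 * m₃ + + 6 * m₅) - k * + 30) - m₃
                       ≡ (+ 5 * m₂ + + 3 * m₃ + + 2 * m₅ - + 10 * k) * + 3
  mod3 = solve-∀
  mod5 : ∀ m₂ m₃ m₅ k → ((+ 15 * m₂ + + 10 * m₃ + + 6 * m₅) - k * + 30) - m₅
                       ≡ (+ 3 * m₂ + + 2 * m₃ + m₅ - + 6 * k) * + 5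
  mod5 = solve-∀

∣-flip : ∀ {n x y} → n ∣ℤ (x - y) → n ∣ℤ (y - x)
∣-flip {n} {x} {y} n∣x-y = subst (n ∣ℤ_) (negate x y) (∣m⇒∣-m n∣x-y)
  where
  negate : ∀ x y → - (x - y) ≡ y - x
  negate = solve-∀

index-gap : ∀ s {i j} → i ≤ j → + (s ℕ.+ j) ≡ + (s ℕ.+ i) + + (j ∸ i)
index-gap s {i} {j} i≤j = trans (cong (λ k → + (s ℕ.+ k)) (sym (ℕᵖ.m+[n∸m]≡n i≤j)))
  (trans (cong +_ (sym (ℕᵖ.+-assoc s i (j ∸ i)))) (ℤᵖ.pos-+ (s ℕ.+ i) (j ∸ i)))

n∣j∸i⇒i%n≡j%n : ∀ {n i j} .{{_ : NonZero n}} → i ≤ j → n ∣ℕ (j ∸ i) → i % n ≡ j % n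
n∣j∸i⇒i%n≡j%n {n} {i} {j} i≤j (ℕᵈ.divides k j∸i≡kn) = begin
  i % n              ≡⟨ sym ([m+kn]%n≡m%n i k n) ⟩
  (i ℕ.+ k ℕ.* n) % n ≡⟨ cong (λ t → (i ℕ.+ t) % n) (sym j∸i≡kn) ⟩
  (i ℕ.+ (j ∸ i)) % n ≡⟨ cong (_% n) (ℕᵖ.m+[n∸m]≡n i≤j) ⟩
  j % n              ∎
  where open ≡-Reasoning

i%n≡r⇒n∣i-r : ∀ {n i r} .{{_ : NonZero n}} → i % n ≡ r → + n ∣ℤ (+ i - + r)
i%n≡r⇒n∣i-r {n} {i} {r} i%n≡r = divides (+ (i ℕ./ n)) (begin
  + i - + r                          ≡⟨ cong (λ t → + t - + r) (m≡m%n+[m/n]*n i n) ⟩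
  + (i % n ℕ.+ i ℕ./ n ℕ.* n) - + r  ≡⟨ cong (λ t → + (t ℕ.+ i ℕ./ n ℕ.* n) - + r) i%n≡r ⟩
  + (r ℕ.+ i ℕ./ n ℕ.* n) - + r      ≡⟨ cong (_- + r) (trans (ℤᵖ.pos-+ r _)
                                                                (cong (λ t → + r + t) (ℤᵖ.pos-* (i ℕ./ n) n))) ⟩
  (+ r + + (i ℕ./ n) * + n) - + r    ≡⟨ cancel (+ r) (+ (i ℕ./ n) * + n) ⟩
  + (i ℕ./ n) * + n                  ∎)
  where
  open ≡-Reasoning
  cancel : ∀ u v → (u + v) - u ≡ v
  cancel = solve-∀

m<n∸o⇒m+o<n : ∀ {m n o} → m < n ∸ o → m ℕ.+ o < n
m<n∸o⇒m+o<n {m} {n}     {zero}  m<n   = subst (_< n) (sym (ℕᵖ.+-identityʳ m)) m<n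
m<n∸o⇒m+o<n {m} {suc n} {suc o} m<n∸o = subst (_< suc n) (sym (ℕᵖ.+-suc m o)) (s≤s (m<n∸o⇒m+o<n m<n∸o))

module _ {a δ : 𝔾} (a⊥δ : Coprime a δ) where

  α : ℕ → 𝔾
  α k = seqα a δ (+ k)

  column : ℕ → SmallPrime → Vec Bool 7
  column s P = tabulate λ i → isYes (P π∣? α (s ℕ.+ toℕ i))

  column-at : ∀ s P {i} → i < 7 → column s P at i ≡ isYes (P π∣? α (s ℕ.+ i))
  column-at s P = at-tabulate (λ i → isYes (P π∣? α (s ℕ.+ i)))

  column⇒∣ : ∀ {s P i} → i < 7 → T (column s P at i) → π P ∣ α (s ℕ.+ i)
  column⇒∣ {s} {P} i<7 marked = toWitness (subst T (column-at s P i<7) marked)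

  ∣⇒column : ∀ {s P i} → i < 7 → π P ∣ α (s ℕ.+ i) → T (column s P at i)
  ∣⇒column {s} {P} i<7 π∣α = subst T (sym (column-at s P i<7)) (fromWitness π∣α)

  column-valid : ∀ s P → Valid P (column s P)
  column-valid s P = congruent , λ i<7-n → shift-up i<7-n , shift-down i<7-n
    where
    n = rationalPrime P
    ordered : ∀ {i j} → i ≤ j → π P ∣ α (s ℕ.+ i) → π P ∣ α (s ℕ.+ j) → i % n ≡ j % n
    ordered {i} {j} i≤j π∣αᵢ π∣αⱼ =
      n∣j∸i⇒i%n≡j%n i≤j (π∣seqα⇒∣gap {a} {δ} P (+ (s ℕ.+ i)) a⊥δ π∣αᵢ
                                        (subst (λ t → π P ∣ seqα a δ t) (index-gap s i≤j) π∣αⱼ))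
    congruent : ∀ {i j} → i < 7 → j < 7 → T (column s P at i) × T (column s P at j) → i % n ≡ j % n
    congruent {i} {j} i<7 j<7 (mᵢ , mⱼ) =
      [ (λ i≤j → ordered i≤j (column⇒∣ {s} {P} i<7 mᵢ) (column⇒∣ {s} {P} j<7 mⱼ))
      , (λ j≤i → sym (ordered j≤i (column⇒∣ {s} {P} j<7 mⱼ) (column⇒∣ {s} {P} i<7 mᵢ))) ]′ (ℕᵖ.≤-total i j)
    n∣gap : ∀ i → + n ∣ℤ (+ (s ℕ.+ (i ℕ.+ n)) - + (s ℕ.+ i))
    n∣gap i = divides (+ 1) (trans (cong (_- + (s ℕ.+ i)) (index-gap s (ℕᵖ.m≤m+n i n)))
                                   (trans (cancel (+ (s ℕ.+ i)) (+ (i ℕ.+ n ∸ i)))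
                                          (trans (cong +_ (ℕᵖ.m+n∸m≡n i n)) (sym (ℤᵖ.*-identityˡ (+ n))))))
      where
      cancel : ∀ u v → (u + v) - u ≡ v
      cancel = solve-∀
    shift-up : ∀ {i} → i < 7 ∸ n → T (column s P at i) → T (column s P at (i ℕ.+ n))
    shift-up {i} i<7-n mᵢ = ∣⇒column {s} {P} (m<n∸o⇒m+o<n i<7-n)
      (∣seqα-congruent {a} {δ} {π P} {n} {+ (s ℕ.+ i)} {+ (s ℕ.+ (i ℕ.+ n))} (π∣rationalPrime P) (n∣gap i)
        (column⇒∣ {s} {P} (ℕᵖ.<-≤-trans i<7-n (ℕᵖ.m∸n≤m 7 n)) mᵢ))
    shift-down : ∀ {i} → i < 7 ∸ n → T (column s P at (i ℕ.+ n)) → T (column s P at i)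
    shift-down {i} i<7-n mᵢ₊ₙ = ∣⇒column {s} {P} (ℕᵖ.<-≤-trans i<7-n (ℕᵖ.m∸n≤m 7 n))
      (∣seqα-congruent {a} {δ} {π P} {n} {+ (s ℕ.+ (i ℕ.+ n))} {+ (s ℕ.+ i)} (π∣rationalPrime P)
        (∣-flip {+ n} {+ (s ℕ.+ (i ℕ.+ n))} {+ (s ℕ.+ i)} (n∣gap i)) (column⇒∣ {s} {P} (m<n∸o⇒m+o<n i<7-n) mᵢ₊ₙ))

  blockPattern : ℕ → Pattern
  blockPattern s = column s two , column s three , column s five , column s five′

  blockPattern∈classPatterns : ∀ s → blockPattern s ∈ classPatterns
  blockPattern∈classPatterns s =
    ∈-cartesianProduct⁺ (column∈classes two) (∈-cartesianProduct⁺ (column∈classes three)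
                          (∈-cartesianProduct⁺ (column∈classes five) (column∈classes five′)))
    where
    column∈classes : ∀ P → column s P ∈ classes P
    column∈classes P = valid⇒∈classes P (Valid⇒valid P {column s P} (column-valid s P))

  marked⇒∣ : ∀ {s} P {i} → i < 7 → T (marking (blockPattern s) P i) → π P ∣ α (s ℕ.+ i)
  marked⇒∣ {s} two   = column⇒∣ {s} {two}
  marked⇒∣ {s} three = column⇒∣ {s} {three}
  marked⇒∣ {s} five  = column⇒∣ {s} {five}
  marked⇒∣ {s} five′ = column⇒∣ {s} {five′}

  ∣⇒marked : ∀ {s} P {i} → i < 7 → π P ∣ α (s ℕ.+ i) → T (marking (blockPattern s) P i)
  ∣⇒marked {s} two   = ∣⇒column {s} {two}
  ∣⇒marked {s} three = ∣⇒column {s} {three}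
  ∣⇒marked {s} five  = ∣⇒column {s} {five}
  ∣⇒marked {s} five′ = ∣⇒column {s} {five′}

  shared-π : ∀ {s i j d} → i < j → j < 7 → ¬ IsUnit d → d ∣ α (s ℕ.+ i) → d ∣ α (s ℕ.+ j) →
             ∃ λ P → π P ∣ α (s ℕ.+ i) × π P ∣ α (s ℕ.+ j)
  shared-π {s} {i} {j} {d} i<j j<7 d-nonUnit d∣αᵢ d∣αⱼ =
    P , ∣-trans {π P} {d} {α (s ℕ.+ i)} π∣d d∣αᵢ , ∣-trans {π P} {d} {α (s ℕ.+ j)} π∣d d∣αⱼ
    where
    gap-bounds : 1 ≤ j ∸ i × j ∸ i ≤ 6
    gap-bounds = ℕᵖ.m<n⇒0<n∸m i<j , ℕᵖ.≤-trans (ℕᵖ.m∸n≤m j i) (ℕᵖ.≤-pred j<7)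
    found = nonUnit∣seqα⇒π∣ {a} {δ} {d} (+ (s ℕ.+ i)) a⊥δ d-nonUnit d∣αᵢ
              (subst (λ t → d ∣ seqα a δ t) (index-gap s (ℕᵖ.<⇒≤ i<j)) d∣αⱼ) (proj₁ gap-bounds) (proj₂ gap-bounds)
    P = proj₁ found
    π∣d = proj₂ found

  shared-π≢ : ∀ {s i j d} → i ≢ j → i < 7 → j < 7 → ¬ IsUnit d → d ∣ α (s ℕ.+ i) → d ∣ α (s ℕ.+ j) →
              ∃ λ P → π P ∣ α (s ℕ.+ i) × π P ∣ α (s ℕ.+ j)
  shared-π≢ {s} {i} {j} {d} i≢j i<7 j<7 d-nonUnit d∣αᵢ d∣αⱼ =
    [ (λ i≤j → shared-π {s} {i} {j} {d} (ℕᵖ.≤∧≢⇒< i≤j i≢j) j<7 d-nonUnit d∣αᵢ d∣αⱼ)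
    , (λ j≤i → let P , π∣αⱼ , π∣αᵢ = shared-π {s} {j} {i} {d} (ℕᵖ.≤∧≢⇒< j≤i (i≢j ∘ sym)) i<7 d-nonUnit d∣αⱼ d∣αᵢ
               in P , π∣αᵢ , π∣αⱼ) ]′ (ℕᵖ.≤-total i j)

  NoneCoprime⇒Covered : ∀ {s n} → n ≤ 7 → NoneCoprimeToOthers a δ s n → Covered n (marking (blockPattern s))
  NoneCoprime⇒Covered {s} {n} n≤7 nc {i} i<n =
    let j , j<n , i≢j , d , d-nonUnit , d∣αᵢ , d∣αⱼ = nc i i<n
        P , π∣αᵢ , π∣αⱼ = shared-π≢ {s} {i} {j} {d} i≢j (bound i<n) (bound j<n) d-nonUnit d∣αᵢ d∣αⱼ
    in j , j<n , i≢j , P , ∣⇒marked {s} P (bound i<n) π∣αᵢ , ∣⇒marked {s} P (bound j<n) π∣αⱼ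
    where
    bound : ∀ {k} → k < n → k < 7
    bound k<n = ℕᵖ.<-≤-trans k<n n≤7

  Covered⇒NoneCoprime : ∀ {s n M} → (∀ P {i} → i < n → T (M P i) → π P ∣ α (s ℕ.+ i)) →
                        Covered n M → NoneCoprimeToOthers a δ s n
  Covered⇒NoneCoprime marks cov i i<n =
    let j , j<n , i≢j , P , Mᵢ , Mⱼ = cov i<n
    in j , j<n , i≢j , π P , π-nonUnit P , marks P i<n Mᵢ , marks P j<n Mⱼ

  NoneCoprime-below-7 : ∀ {s n} → 2 ≤ n → n ≤ 6 → ¬ NoneCoprimeToOthers a δ s n
  NoneCoprime-below-7 {s} 2≤n n≤6 nc =
    classPattern-uncovered (blockPattern∈classPatterns s) (ℕᵖ.≤-trans (s≤s z≤n) 2≤n) n≤6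
      (NoneCoprime⇒Covered {s} (ℕᵖ.m≤n⇒m≤1+n n≤6) nc)

  NoneCoprime-7⇒Condition7 : ∀ {s} → NoneCoprimeToOthers a δ s 7 → Condition7 (marking (blockPattern s))
  NoneCoprime-7⇒Condition7 {s} nc =
    classPattern-covered⇒Condition7 (blockPattern∈classPatterns s) (NoneCoprime⇒Covered {s} ℕᵖ.≤-refl nc)

  Condition7⇒Cond7 : ∀ {L s} → OnLine L a → δ ∥ direction L → Condition7 (marking (blockPattern s)) → Cond7 L a δ
  Condition7⇒Cond7 {L} {s} a-on δ∥ (some₂ , some₃ , i , i<6 , adjacent) =
    member two some₂ , member three some₃ , [ 1+2i-first , 1-2i-first ]′ adjacent
    where
    M = marking (blockPattern s)
    t = + (s ℕ.+ i)
    i<7 : i < 7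
    i<7 = ℕᵖ.m≤n⇒m≤1+n i<6
    i+1<7 : suc i < 7
    i+1<7 = s≤s i<6
    member : ∀ P → (∃ λ j → j < 7 × T (M P j)) → π P ∈𝒟 L
    member P (j , j<7 , Mⱼ) = α (s ℕ.+ j) , seqα-onLine {L} {a} {δ} a-on δ∥ (+ (s ℕ.+ j)) , marked⇒∣ {s} P j<7 Mⱼ
    at-next : ∀ P → T (M P (suc i)) → π P ∣ seqα a δ (t + + 1)
    at-next P M₊ = subst (λ k → π P ∣ seqα a δ k) next (marked⇒∣ {s} P i+1<7 M₊)
      where
      next : + (s ℕ.+ suc i) ≡ t + + 1
      next = trans (cong +_ (trans (ℕᵖ.+-suc s i) (ℕᵖ.+-comm 1 (s ℕ.+ i)))) (ℤᵖ.pos-+ (s ℕ.+ i) 1)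
    Fives = (π five ∈𝒟 L) × (π five′ ∈𝒟 L) × Σ ℤ λ t →
              ((π five ∣ seqα a δ t) × (π five′ ∣ seqα a δ (t + + 1)))
              ⊎ ((π five′ ∣ seqα a δ t) × (π five ∣ seqα a δ (t + + 1)))
    1+2i-first : T (M five i) × T (M five′ (suc i)) → Fives
    1+2i-first (M₅ , M₅′) = member five (i , i<7 , M₅) , member five′ (suc i , i+1<7 , M₅′) , t ,
                            inj₁ (marked⇒∣ {s} five i<7 M₅ , at-next five′ M₅′)
    1-2i-first : T (M five′ i) × T (M five (suc i)) → Fives
    1-2i-first (M₅′ , M₅) = member five (suc i , i+1<7 , M₅) , member five′ (i , i<7 , M₅′) , t ,
                            inj₂ (marked⇒∣ {s} five′ i<7 M₅′ , at-next five M₅)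

  Aligned : ℕ → SmallPrime → ℕ → Set
  Aligned s P r = ∃ λ m → π P ∣ seqα a δ m × + rationalPrime P ∣ℤ (+ (r ℕ.+ s) - m)

  aligned⇒∣ : ∀ {s P r i} → Aligned s P r → i < 7 → T (residueClass P r at i) → π P ∣ α (s ℕ.+ i)
  aligned⇒∣ {s} {P} {r} {i} (m , π∣αₘ , p∣r+s-m) i<7 marked =
    ∣seqα-congruent {a} {δ} {π P} {rationalPrime P} {m} {+ (s ℕ.+ i)} (π∣rationalPrime P)
      (subst (+ rationalPrime P ∣ℤ_) regrouped (∣m∣n⇒∣m+n p∣r+s-m (i%n≡r⇒n∣i-r i%p≡r))) π∣αₘ
    where
    i%p≡r : i % rationalPrime P ≡ r
    i%p≡r = toWitness (subst T (at-tabulate (λ i → isYes (i % rationalPrime P ℕ.≟ r)) i<7) marked)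
    regroup : ∀ r s i m → ((r + s) - m) + (i - r) ≡ (s + i) - m
    regroup = solve-∀
    regrouped : (+ (r ℕ.+ s) - m) + (+ i - + r) ≡ + (s ℕ.+ i) - m
    regrouped = subst₂ (λ u v → (u - m) + (+ i - + r) ≡ v - m) (sym (ℤᵖ.pos-+ r s)) (sym (ℤᵖ.pos-+ s i))
                       (regroup (+ r) (+ s) (+ i) m)

  aligned₁ : ∀ {s P m} → π P ∣ seqα a δ (m + + 1) → + rationalPrime P ∣ℤ (+ s - m) → Aligned s P 1
  aligned₁ {s} {P} {m} π∣αₘ₊₁ p∣s-m = m + + 1 , π∣αₘ₊₁ , subst (+ rationalPrime P ∣ℤ_) (shift (+ s) m) p∣s-m
    where
    shift : ∀ s m → s - m ≡ (+ 1 + s) - (m + + 1)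
    shift = solve-∀

  aligned⇒NoneCoprime : ∀ {s r₅ r₅′} →
    Aligned s two 0 → Aligned s three 0 → Aligned s five r₅ → Aligned s five′ r₅′ →
    T (covered 7 (marking (goodPattern r₅ r₅′))) → NoneCoprimeToOthers a δ s 7
  aligned⇒NoneCoprime {s} {r₅} {r₅′} A₂ A₃ A₅ A₅′ cov =
    Covered⇒NoneCoprime {s} marks (covered⇒Covered {7} {marking (goodPattern r₅ r₅′)} cov)
    where
    marks : ∀ P {i} → i < 7 → T (marking (goodPattern r₅ r₅′) P i) → π P ∣ α (s ℕ.+ i)
    marks two   = aligned⇒∣ {s} {two} A₂
    marks three = aligned⇒∣ {s} {three} A₃
    marks five  = aligned⇒∣ {s} {five} A₅
    marks five′ = aligned⇒∣ {s} {five′} A₅′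

  Cond7⇒Good : ∀ {L} → (∀ {z} → OnLine L z → ∃ λ m → z ≡ seqα a δ m) → Cond7 L a δ → Good a δ 7
  Cond7⇒Good {L} index ((z₂ , z₂-on , π₂∣z₂) , (z₃ , z₃-on , π₃∣z₃) , _ , _ , t , adjacent) =
    s , [ 1+2i-first , 1-2i-first ]′ adjacent
    where
    m₂ = proj₁ (index z₂-on)
    m₃ = proj₁ (index z₃-on)
    s = proj₁ (crt m₂ m₃ t)
    5∣s-t : + 5 ∣ℤ (+ s - t)
    5∣s-t = proj₂ (proj₂ (proj₂ (crt m₂ m₃ t)))
    A₂ : Aligned s two 0
    A₂ = m₂ , subst (π two ∣_) (proj₂ (index z₂-on)) π₂∣z₂ , proj₁ (proj₂ (crt m₂ m₃ t))
    A₃ : Aligned s three 0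
    A₃ = m₃ , subst (π three ∣_) (proj₂ (index z₃-on)) π₃∣z₃ , proj₁ (proj₂ (proj₂ (crt m₂ m₃ t)))
    1+2i-first : (π five ∣ seqα a δ t) × (π five′ ∣ seqα a δ (t + + 1)) → NoneCoprimeToOthers a δ s 7
    1+2i-first (π₅∣αₜ , π₅′∣αₜ₊₁) =
      aligned⇒NoneCoprime {s} A₂ A₃ (t , π₅∣αₜ , 5∣s-t) (aligned₁ {s} {five′} {t} π₅′∣αₜ₊₁ 5∣s-t)
                          (proj₁ goodPattern-covered)
    1-2i-first : (π five′ ∣ seqα a δ t) × (π five ∣ seqα a δ (t + + 1)) → NoneCoprimeToOthers a δ s 7
    1-2i-first (π₅′∣αₜ , π₅∣αₜ₊₁) =
      aligned⇒NoneCoprime {s} A₂ A₃ (aligned₁ {s} {five} {t} π₅∣αₜ₊₁ 5∣s-t) (t , π₅′∣αₜ , 5∣s-t)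
                          (proj₂ goodPattern-covered)

theorem6 : (L : GaussianLine) → Primitive L →
           (α₀ δ : 𝔾) → IsAlpha0 L α₀ → IsDelta L α₀ δ →
           (g : ℕ) → IsG α₀ δ g →
           7 ≤ g × (g ≡ 7 ⇔ Cond7 L α₀ δ)
theorem6 L prim α₀ δ isα isδ g (2≤g , (s , nc) , minimal) = 7≤g , mk⇔ g≡7⇒Cond7 Cond7⇒g≡7
  where
  α₀⊥δ : Coprime α₀ δ
  α₀⊥δ = primitive⇒coprime {L} {α₀} {δ} prim isα isδ
  7≤g : 7 ≤ g
  7≤g = ℕᵖ.≮⇒≥ λ g<7 → NoneCoprime-below-7 α₀⊥δ {s} 2≤g (ℕᵖ.≤-pred g<7) nc
  g≡7⇒Cond7 : g ≡ 7 → Cond7 L α₀ δ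
  g≡7⇒Cond7 refl = Condition7⇒Cond7 α₀⊥δ {L} {s} (proj₁ isα) (δ∥direction {L} {α₀} (proj₁ isα) isδ)
                                      (NoneCoprime-7⇒Condition7 α₀⊥δ {s} nc)
  Cond7⇒g≡7 : Cond7 L α₀ δ → g ≡ 7
  Cond7⇒g≡7 cond = ℕᵖ.≤-antisym (ℕᵖ.≮⇒≥ λ 7<g →
    minimal 7 (s≤s (s≤s z≤n)) 7<g (Cond7⇒Good α₀⊥δ {L} (onLine⇒seqα {L} {α₀} {δ} isα isδ) cond)) 7≤g
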